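{- Let $N$ be a positive integer with $\sigma^{**}(N)=3N$, and let $e,f$ be the exponents with $2^e\,\|\,N$ and $3^f\,\|\,N$. If $e=4$ and $3\le f\le 4$, then $N=2160$.
   Context: $\sigma^{**}(N)$ is the sum of the biunitary divisors of $N$, where a divisor $d$ of $N$ is biunitary if the greatest common unitary divisor of $d$ and $N/d$ is $1$ (a divisor $d$ of $m$ being unitary if $\gcd(d,m/d)=1$). $p^a\,\|\,N$ means $p^a\mid N$ and $p^{a+1}\nmid N$. -}

module Defs where

open import Data.Nat using (ℕ; zero; suc; _+_; _*_; _^_; _⊔_)
open import Data.Nat.Properties using (_≟_)
open import Data.Nat.Divisibility using (_∣_; _∣?_)
open import Data.Nat.DivMod using (_/_)
open import Data.Nat.GCD using (gcd)
open import Data.List using (List; []; _∷_; filter; map; upTo; foldr)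
open import Data.Nat.ListAction using (sum)
open import Data.List.Membership.DecPropositional _≟_ using (_∈?_)
open import Data.Product using (_×_)
open import Relation.Binary.PropositionalEquality using (_≡_)
open import Relation.Nullary using (¬_)
open import Relation.Nullary.Decidable using (_×-dec_)

positivesUpTo : ℕ → List ℕ
positivesUpTo n = map suc (upTo n)

-- cofactor m / d of a divisor d (divisors are taken among positive integers;
-- d = 0 never occurs below, the value is irrelevant for it)
cofactor : ℕ → ℕ → ℕ
cofactor m zero    = 0
cofactor m (suc k) = m / suc k

IsUnitaryDivisor : ℕ → ℕ → Set
IsUnitaryDivisor d m = d ∣ m × gcd d (cofactor m d) ≡ 1

unitaryDivisors : ℕ → List ℕ
unitaryDivisors m =
  filter (λ d → (d ∣? m) ×-dec (gcd d (cofactor m d) ≟ 1)) (positivesUpTo m)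

gcud : ℕ → ℕ → ℕ
gcud a b = foldr _⊔_ 0 (filter (λ d → d ∈? unitaryDivisors b) (unitaryDivisors a))

IsBiunitaryDivisor : ℕ → ℕ → Set
IsBiunitaryDivisor d N = d ∣ N × gcud d (cofactor N d) ≡ 1

σ** : ℕ → ℕ
σ** N = sum (filter (λ d → (d ∣? N) ×-dec (gcud d (cofactor N d) ≟ 1)) (positivesUpTo N))

_^_∥_ : ℕ → ℕ → ℕ → Set
p ^ a ∥ N = (p ^ a ∣ N) × ¬ (p ^ suc a ∣ N)

{-# OPTIONS --safe #-}
-- σ** is multiplicative, with σ**(2⁴) = 27, σ**(3³) = 40 and σ**(3⁴) = 112.  Writing
-- N = 2⁴·3ᶠ·m with gcd(m, 6) = 1, σ**(N) = 3N becomes 5σ**(m) = 6m for f = 3 and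
-- 7σ**(m) = 9m for f = 4.  For odd m > 1 the biunitary divisors of m pair off as
-- d ↔ m/d without fixed points (d = m/d would make d unitarily coprime to itself, so
-- d = 1), hence σ**(m) is even.  This rules out f = 4, as 9m is odd and m = 1 fails.
-- For f = 3, 5 ∣ m; write m = 5ᵍk with 5 ∤ k.  If k > 1, then σ**(m) = σ**(5ᵍ)σ**(k) is
-- divisible by 4, impossible when 5σ**(m) = 6m with m odd.  So m = 5ᵍ, and since every
-- biunitary divisor of 5ᵍ except 1 is a multiple of 5, 5 ∤ σ**(5ᵍ) = 6·5ᵍ⁻¹; thus g = 1
-- and N = 2⁴·3³·5 = 2160.
module Submission where

open import Defs
open import Data.Nat using (ℕ; zero; suc; _+_; _*_; _^_; _⊔_; _≤_; _<_; _<?_; s≤s; z≤n; z<s;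
  NonZero; NonTrivial; >-nonZero; nonTrivial⇒n>1)
open import Data.Nat.Properties
open import Algebra.Properties.CommutativeSemigroup +-commutativeSemigroup using (interchange)
open import Data.Nat.Divisibility
open import Data.Nat.DivMod using (_%_; _/_; m%n<n; %-distribˡ-+; m*n/n≡m)
open import Data.Nat.GCD using (gcd; gcd[m,n]∣m; gcd[m,n]∣n; gcd-greatest; gcd[m,n]≡0⇒m≡0)
open import Data.Nat.Coprimality as Coprimality
  using (Coprime; coprime-divisor; coprime-/gcd; 1-coprimeTo; coprime⇒gcd≡1; gcd≡1⇒coprime)
open import Data.Nat.Primality
  using (Prime; prime?; prime[2]; prime⇒irreducible; prime⇒nonZero; prime⇒nonTrivial)
open import Data.Nat.Induction using (<-rec)
open import Data.Nat.ListAction using (sum)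
open import Data.Nat.ListAction.Properties using (sum-++; sum-↭)
open import Data.List using (List; []; _∷_; _++_; filter; map; foldr; cartesianProduct)
open import Data.List.Properties using (map-++; map-∘; foldr-preservesᵇ; foldr-preservesᵒ)
open import Data.List.Membership.Propositional using (_∈_)
open import Data.List.Membership.Propositional.Properties
  using (∈-++⁺ˡ; ∈-++⁺ʳ; ∈-++⁻; ∈-filter⁺; ∈-filter⁻; ∈-map⁺; ∈-map⁻; ∈-upTo⁺;
         ∈-cartesianProduct⁺; ∈-cartesianProduct⁻)
open import Data.List.Membership.Propositional.Properties.WithK using (unique∧set⇒bag)
open import Data.List.Membership.DecPropositional _≟_ using (_∈?_)
open import Data.List.Relation.Binary.BagAndSetEquality using (∼bag⇒↭)
open import Data.List.Relation.Binary.Disjoint.Propositional using (Disjoint)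
open import Data.List.Relation.Binary.Permutation.Propositional using (_↭_)
import Data.List.Relation.Unary.All as All
import Data.List.Relation.Unary.All.Properties as All
open import Data.List.Relation.Unary.AllPairs using ([]; _∷_)
import Data.List.Relation.Unary.Any as Any
open import Data.List.Relation.Unary.Any using (here; there)
open import Data.List.Relation.Unary.Unique.Propositional using (Unique)
import Data.List.Relation.Unary.Unique.Propositional.Properties as Unique
open import Data.Product using (∃-syntax; ∃₂; _×_; _,_; proj₁; proj₂; uncurry)
import Data.Product as Product
open import Data.Sum using (inj₁; inj₂; [_,_])
open import Function using (_⇔_; mk⇔; _∘_; flip; case_of_)
open import Relation.Nullary using (¬_; ¬?; yes; no; contradiction)
open import Relation.Nullary.Decidable using (_×-dec_; from-yes; from-no)
open import Relation.Binary.PropositionalEquality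
  using (_≡_; _≢_; refl; sym; trans; cong; cong₂; subst; subst₂; module ≡-Reasoning)

private
  variable
    a b c d e k m n o p u x y : ℕ

m*n>0⇒m>0 : ∀ m {n} → 0 < m * n → 0 < m
m*n>0⇒m>0 (suc _) _ = z<s

m*n>0⇒n>0 : ∀ m {n} → 0 < m * n → 0 < n
m*n>0⇒n>0 m {n} rewrite *-comm m n = m*n>0⇒m>0 n

*-reassoc : ∀ a b c d x → a * b ≡ c * d → a * (b * x) ≡ c * (d * x)
*-reassoc a b c d x ab≡cd = trans (sym (*-assoc a b x)) (trans (cong (_* x) ab≡cd) (*-assoc c d x))

m*n≡o⇒m∣o : ∀ m n → m * n ≡ o → m ∣ o
m*n≡o⇒m∣o m n refl = m∣m*n n

m*n≡o⇒n∣o : ∀ m n → m * n ≡ o → n ∣ o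
m*n≡o⇒n∣o m n refl = n∣m*n m

∣⇒>0 : 0 < n → d ∣ n → 0 < d
∣⇒>0 0<n (divides q refl) = m*n>0⇒n>0 q 0<n

coprime-∣ : x ∣ a → y ∣ b → Coprime a b → Coprime x y
coprime-∣ x∣a y∣b a⊥b (d∣x , d∣y) = a⊥b (∣-trans d∣x x∣a , ∣-trans d∣y y∣b)

coprime-*ʳ : Coprime a b → Coprime a c → Coprime a (b * c)
coprime-*ʳ a⊥b a⊥c (d∣a , d∣bc) = a⊥c (d∣a , coprime-divisor (coprime-∣ d∣a ∣-refl a⊥b) d∣bc)

coprime-*ˡ : Coprime a c → Coprime b c → Coprime (a * b) c
coprime-*ˡ a⊥c b⊥c = Coprimality.sym (coprime-*ʳ (Coprimality.sym a⊥c) (Coprimality.sym b⊥c))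

coprime-^ˡ : Coprime a b → ∀ k → Coprime (a ^ k) b
coprime-^ˡ a⊥b zero    = 1-coprimeTo _
coprime-^ˡ a⊥b (suc k) = coprime-*ˡ a⊥b (coprime-^ˡ a⊥b k)

prime∤⇒coprime : Prime p → ¬ p ∣ n → Coprime p n
prime∤⇒coprime pr p∤n (d∣p , d∣n) with prime⇒irreducible pr d∣p
... | inj₁ d≡1  = d≡1
... | inj₂ refl = contradiction d∣n p∤n

∣p^k∧≢1⇒p∣ : Prime p → ∀ k → d ∣ p ^ k → d ≢ 1 → p ∣ d
∣p^k∧≢1⇒p∣ {p} {d} pr k d∣p^k d≢1 with p ∣? d
... | yes p∣d = p∣d
... | no  p∤d = contradiction (coprime-^ˡ (prime∤⇒coprime pr p∤d) k (d∣p^k , ∣-refl)) d≢1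

∣m*n⇒factorise : d ∣ m * n → ∃₂ λ x y → d ≡ x * y × x ∣ m × y ∣ n
∣m*n⇒factorise {d} {m} {n} d∣mn with gcd d m in g≡
... | zero  = 0 , 1 , gcd[m,n]≡0⇒m≡0 g≡ , subst (_∣ m) g≡ (gcd[m,n]∣n d m) , 1∣ n
... | suc _ = g , d′ , d≡gd′ , gcd[m,n]∣n d m , d′∣n
  where
  instance _ = subst NonZero (sym g≡) _
  g = gcd d m
  d′ = d / g
  m′ = m / g
  d≡gd′ : d ≡ g * d′
  d≡gd′ = trans (m∣n⇒n≡m*quotient (gcd[m,n]∣m d m)) (cong (g *_) (sym (n/m≡quotient (gcd[m,n]∣m d m))))
  m≡gm′ : m ≡ g * m′
  m≡gm′ = trans (m∣n⇒n≡m*quotient (gcd[m,n]∣n d m)) (cong (g *_) (sym (n/m≡quotient (gcd[m,n]∣n d m))))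
  d′∣n : d′ ∣ n
  d′∣n = coprime-divisor (coprime-/gcd d m)
           (*-cancelˡ-∣ g (subst₂ _∣_ d≡gd′ (trans (cong (_* n) m≡gm′) (*-assoc g m′ n)) d∣mn))

odd⇒%2≡1 : ¬ 2 ∣ m → m % 2 ≡ 1
odd⇒%2≡1 {m} 2∤m with m % 2 in eq | m%n<n m 2
... | 0 | _ = contradiction (m%n≡0⇒n∣m m 2 eq) 2∤m
... | 1 | _ = refl
... | suc (suc _) | s≤s (s≤s ())

odd+odd⇒even : ¬ 2 ∣ m → ¬ 2 ∣ n → 2 ∣ m + n
odd+odd⇒even {m} {n} 2∤m 2∤n = m%n≡0⇒n∣m (m + n) 2 (begin
  (m + n) % 2           ≡⟨ %-distribˡ-+ m n 2 ⟩
  (m % 2 + n % 2) % 2   ≡⟨ cong₂ (λ i j → (i + j) % 2) (odd⇒%2≡1 2∤m) (odd⇒%2≡1 2∤n) ⟩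
  0                     ∎)
  where open ≡-Reasoning

∥⇒≡^*∤ : ∀ p a → p ^ a ∥ n → ∃[ m ] n ≡ p ^ a * m × ¬ p ∣ m
∥⇒≡^*∤ p a (divides m n≡mpᵃ , pᵃ⁺¹∤n) =
  m , trans n≡mpᵃ (*-comm m (p ^ a)) ,
  λ p∣m → pᵃ⁺¹∤n (subst (p ^ suc a ∣_) (sym n≡mpᵃ) (*-monoˡ-∣ (p ^ a) p∣m))

∥-cancelˡ : ∀ p a → Coprime (p ^ a) c → p ^ a ∥ (c * m) → p ^ a ∥ m
∥-cancelˡ {c} p a pᵃ⊥c (pᵃ∣cm , pᵃ⁺¹∤cm) =
  coprime-divisor pᵃ⊥c pᵃ∣cm , λ pᵃ⁺¹∣m → pᵃ⁺¹∤cm (∣-trans pᵃ⁺¹∣m (n∣m*n c))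

factorOut : ∀ p .{{p>1 : NonTrivial p}} n → 0 < n → ∃₂ λ g k → n ≡ p ^ g * k × ¬ p ∣ k
factorOut p {{p>1}} = <-rec P step
  where
  P : ℕ → Set
  P n = 0 < n → ∃₂ λ g k → n ≡ p ^ g * k × ¬ p ∣ k
  step : ∀ n → (∀ {q} → q < n → P q) → P n
  step n rec 0<n with p ∣? n
  ... | no  p∤n = 0 , n , sym (*-identityˡ n) , p∤n
  ... | yes p∣n@(divides q n≡qp)
    with g , k , q≡pᵍk , p∤k ← rec (quotient-< p∣n {{p>1}} {{>-nonZero 0<n}})
                                   (m*n>0⇒m>0 q (subst (0 <_) n≡qp 0<n))
    = suc g , k , (begin
        n               ≡⟨ n≡qp ⟩
        q * p           ≡⟨ *-comm q p ⟩
        p * q           ≡⟨ cong (p *_) q≡pᵍk ⟩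
        p * (p ^ g * k) ≡⟨ *-assoc p (p ^ g) k ⟨
        p ^ suc g * k   ∎) , p∤k
    where open ≡-Reasoning

-- Unitary and biunitary divisors

infix 4 _∣*_ _∣**_

_∣*_ : ℕ → ℕ → Set
u ∣* n = ∃[ w ] u * w ≡ n × Coprime u w

UnitarilyCoprime : ℕ → ℕ → Set
UnitarilyCoprime m n = ∀ {u} → u ∣* m → u ∣* n → u ≡ 1

_∣**_ : ℕ → ℕ → Set
d ∣** n = ∃[ e ] d * e ≡ n × UnitarilyCoprime d e

∣*⇒∣ : u ∣* n → u ∣ n
∣*⇒∣ {u} (w , uw≡n , _) = m*n≡o⇒m∣o u w uw≡n

∣**⇒∣ : d ∣** n → d ∣ n
∣**⇒∣ {d} (e , de≡n , _) = m*n≡o⇒m∣o d e de≡n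

1∣* : ∀ n → 1 ∣* n
1∣* n = n , *-identityˡ n , 1-coprimeTo n

1∣** : ∀ n → 1 ∣** n
1∣** n = n , *-identityˡ n , λ {u} (w , uw≡1 , _) _ → m*n≡1⇒m≡1 u w uw≡1

∣*-refl : ∀ n → n ∣* n
∣*-refl n = 1 , *-identityʳ n , Coprimality.sym (1-coprimeTo n)

unitarilyCoprime-sym : UnitarilyCoprime m n → UnitarilyCoprime n m
unitarilyCoprime-sym m⊥n u∣*n u∣*m = m⊥n u∣*m u∣*n

unitarilyCoprime[n,n]⇒n≡1 : UnitarilyCoprime n n → n ≡ 1
unitarilyCoprime[n,n]⇒n≡1 {n} n⊥n = n⊥n (∣*-refl n) (∣*-refl n)

∣*-*ʳ : Coprime m n → u ∣* m → u ∣* m * n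
∣*-*ʳ {m} {n} {u} m⊥n (w , uw≡m , u⊥w) =
  w * n , trans (sym (*-assoc u w n)) (cong (_* n) uw≡m) ,
  coprime-*ʳ u⊥w (coprime-∣ (m*n≡o⇒m∣o u w uw≡m) ∣-refl m⊥n)

-- Split x = x₁ * x₂ with x₁ ∣ u and x₂ ∣ w; then gcd u a is exactly x₁.
gcd-∣* : Coprime a b → x ∣ a → y ∣ b → u ∣* x * y → gcd u a ∣* x
gcd-∣* {a} {b} {x} {y} {u} a⊥b x∣a y∣b (w , uw≡xy , u⊥w)
  with x₁ , x₂ , x≡x₁x₂ , x₁∣u , x₂∣w ←
         ∣m*n⇒factorise {m = u} {n = w} (subst (x ∣_) (sym uw≡xy) (m∣m*n y))
  = x₂ , trans (cong (_* x₂) g≡x₁) (sym x≡x₁x₂) , g⊥x₂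
  where
  g = gcd u a
  g⊥x₂ : Coprime g x₂
  g⊥x₂ = coprime-∣ (gcd[m,n]∣m u a) x₂∣w u⊥w
  g∣x : g ∣ x
  g∣x = coprime-divisor (coprime-∣ (gcd[m,n]∣n u a) y∣b a⊥b)
          (subst (g ∣_) (trans uw≡xy (*-comm x y)) (∣-trans (gcd[m,n]∣m u a) (m∣m*n w)))
  g≡x₁ : g ≡ x₁
  g≡x₁ = ∣-antisym (coprime-divisor g⊥x₂ (subst (g ∣_) (trans x≡x₁x₂ (*-comm x₁ x₂)) g∣x))
                   (gcd-greatest x₁∣u (∣-trans (m*n≡o⇒m∣o x₁ x₂ (sym x≡x₁x₂)) x∣a))

unitarilyCoprime-*⁻ : ∀ {d₁ e₁ d₂ e₂} → Coprime a b → d₁ * e₁ ≡ a → d₂ * e₂ ≡ b →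
                      UnitarilyCoprime (d₁ * d₂) (e₁ * e₂) → UnitarilyCoprime d₁ e₁
unitarilyCoprime-*⁻ {d₁ = d₁} {e₁} {d₂} {e₂} a⊥b d₁e₁≡a d₂e₂≡b d⊥e u∣*d₁ u∣*e₁ =
  d⊥e (∣*-*ʳ (coprime-∣ (m*n≡o⇒m∣o d₁ e₁ d₁e₁≡a) (m*n≡o⇒m∣o d₂ e₂ d₂e₂≡b) a⊥b) u∣*d₁)
      (∣*-*ʳ (coprime-∣ (m*n≡o⇒n∣o d₁ e₁ d₁e₁≡a) (m*n≡o⇒n∣o d₂ e₂ d₂e₂≡b) a⊥b) u∣*e₁)

unitarilyCoprime-*⁺ : ∀ {d₁ e₁ d₂ e₂} → Coprime a b → d₁ * e₁ ≡ a → d₂ * e₂ ≡ b →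
                      UnitarilyCoprime d₁ e₁ → UnitarilyCoprime d₂ e₂ →
                      UnitarilyCoprime (d₁ * d₂) (e₁ * e₂)
unitarilyCoprime-*⁺ {a} {b} {d₁} {e₁} {d₂} {e₂} a⊥b d₁e₁≡a d₂e₂≡b d₁⊥e₁ d₂⊥e₂ {u} u∣*d u∣*e =
  ∣1⇒≡1 (subst (u ∣_) gcd[u,b]≡1 (gcd-greatest ∣-refl u∣b))
  where
  d₁∣a = m*n≡o⇒m∣o d₁ e₁ d₁e₁≡a
  e₁∣a = m*n≡o⇒n∣o d₁ e₁ d₁e₁≡a
  d₂∣b = m*n≡o⇒m∣o d₂ e₂ d₂e₂≡b
  e₂∣b = m*n≡o⇒n∣o d₂ e₂ d₂e₂≡b
  b⊥a = Coprimality.sym a⊥b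
  gcd[u,a]≡1 : gcd u a ≡ 1
  gcd[u,a]≡1 = d₁⊥e₁ (gcd-∣* a⊥b d₁∣a d₂∣b u∣*d) (gcd-∣* a⊥b e₁∣a e₂∣b u∣*e)
  gcd[u,b]≡1 : gcd u b ≡ 1
  gcd[u,b]≡1 = d₂⊥e₂ (gcd-∣* b⊥a d₂∣b d₁∣a (subst (u ∣*_) (*-comm d₁ d₂) u∣*d))
                     (gcd-∣* b⊥a e₂∣b e₁∣a (subst (u ∣*_) (*-comm e₁ e₂) u∣*e))
  u∣b : u ∣ b
  u∣b = coprime-divisor (gcd≡1⇒coprime gcd[u,a]≡1) (∣-trans (∣*⇒∣ u∣*d) (*-pres-∣ d₁∣a d₂∣b))

∣**-*⁺ : ∀ {d₁ d₂} → Coprime a b → d₁ ∣** a → d₂ ∣** b → d₁ * d₂ ∣** a * b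
∣**-*⁺ {a} {b} {d₁} {d₂} a⊥b (e₁ , d₁e₁≡a , d₁⊥e₁) (e₂ , d₂e₂≡b , d₂⊥e₂) =
  e₁ * e₂ , trans ([m*n]*[o*p]≡[m*o]*[n*p] d₁ d₂ e₁ e₂) (cong₂ _*_ d₁e₁≡a d₂e₂≡b) ,
  unitarilyCoprime-*⁺ a⊥b d₁e₁≡a d₂e₂≡b d₁⊥e₁ d₂⊥e₂

∣**-*⁻ : Coprime a b → 0 < a * b → d ∣** a * b → ∃₂ λ d₁ d₂ → d ≡ d₁ * d₂ × d₁ ∣** a × d₂ ∣** b
∣**-*⁻ {a} {b} {d} a⊥b 0<ab (e , de≡ab , d⊥e)
  with d₁ , d₂ , d≡d₁d₂ , divides e₁ a≡e₁d₁ , divides e₂ b≡e₂d₂ ←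
         ∣m*n⇒factorise {m = a} {n = b} (m*n≡o⇒m∣o d e de≡ab)
  = d₁ , d₂ , d≡d₁d₂ ,
    (e₁ , d₁e₁≡a , unitarilyCoprime-*⁻ a⊥b d₁e₁≡a d₂e₂≡b d₁d₂⊥e₁e₂) ,
    (e₂ , d₂e₂≡b , unitarilyCoprime-*⁻ (Coprimality.sym a⊥b) d₂e₂≡b d₁e₁≡a
                     (subst₂ UnitarilyCoprime (*-comm d₁ d₂) (*-comm e₁ e₂) d₁d₂⊥e₁e₂))
  where
  d₁e₁≡a = trans (*-comm d₁ e₁) (sym a≡e₁d₁)
  d₂e₂≡b = trans (*-comm d₂ e₂) (sym b≡e₂d₂)
  e≡e₁e₂ : e ≡ e₁ * e₂
  e≡e₁e₂ = *-cancelˡ-≡ e (e₁ * e₂) d {{>-nonZero (∣⇒>0 0<ab (m*n≡o⇒m∣o d e de≡ab))}} (begin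
    d * e                 ≡⟨ de≡ab ⟩
    a * b                 ≡⟨ cong₂ _*_ d₁e₁≡a d₂e₂≡b ⟨
    (d₁ * e₁) * (d₂ * e₂) ≡⟨ [m*n]*[o*p]≡[m*o]*[n*p] d₁ e₁ d₂ e₂ ⟩
    (d₁ * d₂) * (e₁ * e₂) ≡⟨ cong (_* (e₁ * e₂)) d≡d₁d₂ ⟨
    d * (e₁ * e₂)         ∎)
    where open ≡-Reasoning
  d₁d₂⊥e₁e₂ : UnitarilyCoprime (d₁ * d₂) (e₁ * e₂)
  d₁d₂⊥e₁e₂ = subst₂ UnitarilyCoprime d≡d₁d₂ e≡e₁e₂ d⊥e

gcd[xy,a]≡x : Coprime a b → x ∣ a → y ∣ b → gcd (x * y) a ≡ x
gcd[xy,a]≡x {a} {b} {x} {y} a⊥b x∣a y∣b = ∣-antisym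
  (coprime-divisor (coprime-∣ (gcd[m,n]∣n (x * y) a) y∣b a⊥b)
                   (subst (gcd (x * y) a ∣_) (*-comm x y) (gcd[m,n]∣m (x * y) a)))
  (gcd-greatest (m∣m*n y) x∣a)

coprime-factorisation-unique : ∀ {x′ y′} → Coprime a b → 0 < a →
                               x ∣ a → y ∣ b → x′ ∣ a → y′ ∣ b → x * y ≡ x′ * y′ → x ≡ x′ × y ≡ y′
coprime-factorisation-unique {a} {b} {x} {y} {x′} {y′} a⊥b 0<a x∣a y∣b x′∣a y′∣b xy≡x′y′ = x≡x′ ,
  *-cancelˡ-≡ y y′ x {{>-nonZero (∣⇒>0 0<a x∣a)}} (trans xy≡x′y′ (cong (_* y′) (sym x≡x′)))
  where
  x≡x′ : x ≡ x′
  x≡x′ = begin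
    x               ≡⟨ gcd[xy,a]≡x a⊥b x∣a y∣b ⟨
    gcd (x * y) a   ≡⟨ cong (λ z → gcd z a) xy≡x′y′ ⟩
    gcd (x′ * y′) a ≡⟨ gcd[xy,a]≡x a⊥b x′∣a y′∣b ⟩
    x′              ∎
    where open ≡-Reasoning

-- unitaryDivisors n = divisorsWith gcd n and σ** n = sum (divisorsWith gcud n) hold by refl.
divisorsWith : (ℕ → ℕ → ℕ) → ℕ → List ℕ
divisorsWith h n = filter (λ d → (d ∣? n) ×-dec (h d (cofactor n d) ≟ 1)) (positivesUpTo n)

cofactor-* : 0 < d → d * e ≡ n → cofactor n d ≡ e
cofactor-* {suc k} {e} _ refl = trans (cong (_/ suc k) (*-comm (suc k) e)) (m*n/n≡m e (suc k))

divisorsWith-unique : ∀ h n → Unique (divisorsWith h n)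
divisorsWith-unique h n = Unique.filter⁺ _ (Unique.map⁺ suc-injective (Unique.upTo⁺ n))

∈-positivesUpTo⁺ : 0 < d → d ≤ n → d ∈ positivesUpTo n
∈-positivesUpTo⁺ {suc _} _ d≤n = ∈-map⁺ suc (∈-upTo⁺ d≤n)

∈-divisorsWith⁺ : ∀ {h} → 0 < n → d * e ≡ n → h d e ≡ 1 → d ∈ divisorsWith h n
∈-divisorsWith⁺ {n} {d} {e} {h} 0<n de≡n hde≡1 = ∈-filter⁺ _ (∈-positivesUpTo⁺ 0<d d≤n)
  (divides e (trans (sym de≡n) (*-comm d e)) , subst (λ c → h d c ≡ 1) (sym (cofactor-* 0<d de≡n)) hde≡1)
  where
  0<d = m*n>0⇒m>0 d (subst (0 <_) (sym de≡n) 0<n)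
  d≤n = subst (d ≤_) de≡n (m≤m*n d e {{>-nonZero (m*n>0⇒n>0 d (subst (0 <_) (sym de≡n) 0<n))}})

∈-divisorsWith⁻ : ∀ {h} → 0 < n → d ∈ divisorsWith h n → ∃[ e ] d * e ≡ n × h d e ≡ 1
∈-divisorsWith⁻ {n} {d} {h} 0<n d∈ with ∈-filter⁻ _ {xs = positivesUpTo n} d∈
... | _ , d∣n@(divides e n≡ed) , hd[n/d]≡1 =
  e , de≡n , subst (λ c → h d c ≡ 1) (cofactor-* (∣⇒>0 0<n d∣n) de≡n) hd[n/d]≡1
  where de≡n = trans (*-comm d e) (sym n≡ed)

∈-unitaryDivisors⁺ : 0 < n → u ∣* n → u ∈ unitaryDivisors n
∈-unitaryDivisors⁺ 0<n (w , uw≡n , u⊥w) = ∈-divisorsWith⁺ {h = gcd} 0<n uw≡n (coprime⇒gcd≡1 u⊥w)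

∈-unitaryDivisors⁻ : 0 < n → u ∈ unitaryDivisors n → u ∣* n
∈-unitaryDivisors⁻ 0<n u∈ with w , uw≡n , gcd[u,w]≡1 ← ∈-divisorsWith⁻ {h = gcd} 0<n u∈ =
  w , uw≡n , gcd≡1⇒coprime gcd[u,w]≡1

∈⇒≤foldr-⊔ : ∀ {xs} → x ∈ xs → x ≤ foldr _⊔_ 0 xs
∈⇒≤foldr-⊔ {xs = xs} x∈xs =
  foldr-preservesᵒ (λ i j → [ m≤n⇒m≤n⊔o j , m≤n⇒m≤o⊔n i ]) 0 xs (inj₂ (Any.map ≤-reflexive x∈xs))

gcud≡1⇒unitarilyCoprime : 0 < m → 0 < n → gcud m n ≡ 1 → UnitarilyCoprime m n
gcud≡1⇒unitarilyCoprime 0<m 0<n gcud≡1 {u} u∣*m u∣*n = ≤-antisym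
  (subst (u ≤_) gcud≡1 (∈⇒≤foldr-⊔
    (∈-filter⁺ _ (∈-unitaryDivisors⁺ 0<m u∣*m) (∈-unitaryDivisors⁺ 0<n u∣*n))))
  (∣⇒>0 0<m (∣*⇒∣ u∣*m))

unitarilyCoprime⇒gcud≡1 : 0 < m → 0 < n → UnitarilyCoprime m n → gcud m n ≡ 1
unitarilyCoprime⇒gcud≡1 {m} {n} 0<m 0<n m⊥n = ≤-antisym
  (foldr-preservesᵇ ⊔-lub z≤n (All.tabulate common≤1))
  (∈⇒≤foldr-⊔ (∈-filter⁺ _ (∈-unitaryDivisors⁺ 0<m (1∣* m)) (∈-unitaryDivisors⁺ 0<n (1∣* n))))
  where
  common≤1 : ∀ {u} → u ∈ filter (_∈? unitaryDivisors n) (unitaryDivisors m) → u ≤ 1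
  common≤1 u∈ with u∈m , u∈n ← ∈-filter⁻ _ {xs = unitaryDivisors m} u∈ =
    ≤-reflexive (m⊥n (∈-unitaryDivisors⁻ 0<m u∈m) (∈-unitaryDivisors⁻ 0<n u∈n))

biunitaryDivisors : ℕ → List ℕ
biunitaryDivisors = divisorsWith gcud

∈-biunitaryDivisors⁺ : 0 < n → d ∣** n → d ∈ biunitaryDivisors n
∈-biunitaryDivisors⁺ {n} {d} 0<n (e , de≡n , d⊥e) = ∈-divisorsWith⁺ 0<n de≡n
  (unitarilyCoprime⇒gcud≡1 (m*n>0⇒m>0 d 0<de) (m*n>0⇒n>0 d 0<de) d⊥e)
  where 0<de = subst (0 <_) (sym de≡n) 0<n

∈-biunitaryDivisors⁻ : 0 < n → d ∈ biunitaryDivisors n → d ∣** n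
∈-biunitaryDivisors⁻ {n} {d} 0<n d∈ =
  let e , de≡n , gcud≡1 = ∈-divisorsWith⁻ {h = gcud} 0<n d∈
      0<de = subst (0 <_) (sym de≡n) 0<n
  in  e , de≡n , gcud≡1⇒unitarilyCoprime (m*n>0⇒m>0 d 0<de) (m*n>0⇒n>0 d 0<de) gcud≡1

unique∧⇔⇒↭ : {A : Set} {xs ys : List A} → Unique xs → Unique ys → (∀ {z} → z ∈ xs ⇔ z ∈ ys) → xs ↭ ys
unique∧⇔⇒↭ xs! ys! xs⇔ys = ∼bag⇒↭ (unique∧set⇒bag xs! ys! xs⇔ys)

unique-map⁺ : {A B : Set} {f : A → B} {xs : List A} →
              (∀ {v w} → v ∈ xs → w ∈ xs → f v ≡ f w → v ≡ w) → Unique xs → Unique (map f xs)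
unique-map⁺ f-inj []            = []
unique-map⁺ f-inj (v∉xs ∷ xs!) =
  All.map⁺ (All.tabulate λ w∈xs fv≡fw → All.lookup v∉xs w∈xs (f-inj (here refl) (there w∈xs) fv≡fw)) ∷
  unique-map⁺ (λ v∈ w∈ → f-inj (there v∈) (there w∈)) xs!

*-distribˡ-sum : ∀ x ys → x * sum ys ≡ sum (map (x *_) ys)
*-distribˡ-sum x []       = *-zeroʳ x
*-distribˡ-sum x (y ∷ ys) = trans (*-distribˡ-+ x y (sum ys)) (cong (x * y +_) (*-distribˡ-sum x ys))

sum-cartesianProduct : ∀ xs ys → sum (map (uncurry _*_) (cartesianProduct xs ys)) ≡ sum xs * sum ys
sum-cartesianProduct []       ys = refl
sum-cartesianProduct (x ∷ xs) ys = begin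
  sum (map (uncurry _*_) (map (x ,_) ys ++ cartesianProduct xs ys))
    ≡⟨ cong sum (map-++ (uncurry _*_) (map (x ,_) ys) (cartesianProduct xs ys)) ⟩
  sum (map (uncurry _*_) (map (x ,_) ys) ++ map (uncurry _*_) (cartesianProduct xs ys))
    ≡⟨ sum-++ (map (uncurry _*_) (map (x ,_) ys)) _ ⟩
  sum (map (uncurry _*_) (map (x ,_) ys)) + sum (map (uncurry _*_) (cartesianProduct xs ys))
    ≡⟨ cong₂ _+_ (cong sum (sym (map-∘ ys))) (sum-cartesianProduct xs ys) ⟩
  sum (map (x *_) ys) + sum xs * sum ys
    ≡⟨ cong (_+ sum xs * sum ys) (*-distribˡ-sum x ys) ⟨
  x * sum ys + sum xs * sum ys
    ≡⟨ *-distribʳ-+ (sum ys) x (sum xs) ⟨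
  (x + sum xs) * sum ys ∎
  where open ≡-Reasoning


∣sum : ∀ {xs} → (∀ {x} → x ∈ xs → k ∣ x) → k ∣ sum xs
∣sum {k} k∣xs = foldr-preservesᵇ ∣m∣n⇒∣m+n (k ∣0) (All.tabulate k∣xs)

sum+sum-map : ∀ (f : ℕ → ℕ) xs → sum xs + sum (map f xs) ≡ sum (map (λ x → x + f x) xs)
sum+sum-map f []       = refl
sum+sum-map f (x ∷ xs) =
  trans (interchange x (sum xs) (f x) (sum (map f xs))) (cong (x + f x +_) (sum+sum-map f xs))

-- xs is a permutation of ys ++ map ι ys, where ys keeps the x with x < ι x.
∣sum-involution : ∀ (ι : ℕ → ℕ) {xs} → Unique xs →
                  (∀ {x} → x ∈ xs → ι x ∈ xs) → (∀ {x} → x ∈ xs → ι (ι x) ≡ x) →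
                  (∀ {x} → x ∈ xs → ι x ≢ x) → (∀ {x} → x ∈ xs → k ∣ x + ι x) → k ∣ sum xs
∣sum-involution {k} ι {xs} xs! ι-closed ι-involutive ι-fixFree k∣x+ιx =
  subst (k ∣_) sum[xs]≡ (∣sum k∣pair)
  where
  P? = λ x → x <? ι x
  ys = filter P? xs
  ys! = Unique.filter⁺ P? xs!

  ∈ys⁻ : ∀ {y} → y ∈ ys → y ∈ xs × y < ι y
  ∈ys⁻ = ∈-filter⁻ P? {xs = xs}

  ι-injective : ∀ {v w} → v ∈ ys → w ∈ ys → ι v ≡ ι w → v ≡ w
  ι-injective v∈ w∈ ιv≡ιw = trans (sym (ι-involutive (proj₁ (∈ys⁻ v∈))))
                                  (trans (cong ι ιv≡ιw) (ι-involutive (proj₁ (∈ys⁻ w∈))))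

  disjoint : Disjoint ys (map ι ys)
  disjoint {x} (x∈ys , x∈ιys) with y , y∈ys , refl ← ∈-map⁻ ι x∈ιys =
    <-asym (proj₂ (∈ys⁻ y∈ys)) (subst (ι y <_) (ι-involutive (proj₁ (∈ys⁻ y∈ys))) (proj₂ (∈ys⁻ x∈ys)))

  to : ∀ {x} → x ∈ xs → x ∈ ys ++ map ι ys
  to {x} x∈xs with P? x
  ... | yes x<ιx = ∈-++⁺ˡ (∈-filter⁺ P? x∈xs x<ιx)
  ... | no  x≮ιx =
    ∈-++⁺ʳ ys (subst (_∈ map ι ys) (ι-involutive x∈xs) (∈-map⁺ ι (∈-filter⁺ P? (ι-closed x∈xs) ιx<ιιx)))
    where
    ιx<ιιx : ι x < ι (ι x)
    ιx<ιιx = subst (ι x <_) (sym (ι-involutive x∈xs)) (≤∧≢⇒< (≮⇒≥ x≮ιx) (ι-fixFree x∈xs))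

  from : ∀ {x} → x ∈ ys ++ map ι ys → x ∈ xs
  from x∈ with ∈-++⁻ ys x∈
  ... | inj₁ x∈ys  = proj₁ (∈ys⁻ x∈ys)
  ... | inj₂ x∈ιys with y , y∈ys , refl ← ∈-map⁻ ι x∈ιys = ι-closed (proj₁ (∈ys⁻ y∈ys))

  xs↭ : xs ↭ ys ++ map ι ys
  xs↭ = unique∧⇔⇒↭ xs! (Unique.++⁺ ys! (unique-map⁺ ι-injective ys!) disjoint) (mk⇔ to from)

  sum[xs]≡ : sum (map (λ x → x + ι x) ys) ≡ sum xs
  sum[xs]≡ = begin
    sum (map (λ x → x + ι x) ys) ≡⟨ sum+sum-map ι ys ⟨
    sum ys + sum (map ι ys)      ≡⟨ sum-++ ys (map ι ys) ⟨
    sum (ys ++ map ι ys)         ≡⟨ sum-↭ xs↭ ⟨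
    sum xs                       ∎
    where open ≡-Reasoning

  k∣pair : ∀ {z} → z ∈ map (λ x → x + ι x) ys → k ∣ z
  k∣pair z∈ with x , x∈ys , refl ← ∈-map⁻ (λ x → x + ι x) z∈ = k∣x+ιx (proj₁ (∈ys⁻ x∈ys))

sum≡x+sum[filter≢x] : ∀ {xs} → Unique xs → x ∈ xs → sum xs ≡ x + sum (filter (λ y → ¬? (y ≟ x)) xs)
sum≡x+sum[filter≢x] {x} {xs} xs! x∈xs =
  sum-↭ (unique∧⇔⇒↭ xs! (x∉rest ∷ Unique.filter⁺ ≢x? xs!) (mk⇔ to from))
  where
  ≢x? = λ y → ¬? (y ≟ x)
  rest = filter ≢x? xs

  x∉rest : All.All (x ≢_) rest
  x∉rest = All.tabulate λ y∈ x≡y → proj₂ (∈-filter⁻ ≢x? {xs = xs} y∈) (sym x≡y)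

  to : ∀ {y} → y ∈ xs → y ∈ x ∷ rest
  to {y} y∈xs with y ≟ x
  ... | yes y≡x = here y≡x
  ... | no  y≢x = there (∈-filter⁺ ≢x? y∈xs y≢x)

  from : ∀ {y} → y ∈ x ∷ rest → y ∈ xs
  from (here refl) = x∈xs
  from (there y∈)  = proj₁ (∈-filter⁻ ≢x? {xs = xs} y∈)

-- Arithmetic of σ**

-- Below, case_of_ replaces with: abstracting over terms that mention σ** or biunitaryDivisors
-- makes Agda normalise the well-founded recursion inside gcd, which is very slow.
σ**-multiplicative : Coprime a b → 0 < a → 0 < b → σ** (a * b) ≡ σ** a * σ** b
σ**-multiplicative {a} {b} a⊥b 0<a 0<b = begin
  σ** (a * b)                   ≡⟨ sum-↭ products↭divisors ⟨
  sum (map (uncurry _*_) pairs) ≡⟨ sum-cartesianProduct (biunitaryDivisors a) (biunitaryDivisors b) ⟩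
  σ** a * σ** b                 ∎
  where
  open ≡-Reasoning
  0<ab : 0 < a * b
  0<ab = *-mono-< 0<a 0<b
  pairs : List (ℕ × ℕ)
  pairs = cartesianProduct (biunitaryDivisors a) (biunitaryDivisors b)

  ∈pairs⁻ : ∀ {d₁ d₂} → (d₁ , d₂) ∈ pairs → d₁ ∣** a × d₂ ∣** b
  ∈pairs⁻ = Product.map (∈-biunitaryDivisors⁻ 0<a) (∈-biunitaryDivisors⁻ 0<b)
          ∘ ∈-cartesianProduct⁻ (biunitaryDivisors a) (biunitaryDivisors b)

  product-injective : ∀ {p q} → p ∈ pairs → q ∈ pairs → uncurry _*_ p ≡ uncurry _*_ q → p ≡ q
  product-injective p∈ q∈ =
    let (d₁∣**a , d₂∣**b) = ∈pairs⁻ p∈ ; (d₁′∣**a , d₂′∣**b) = ∈pairs⁻ q∈ in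
    uncurry (cong₂ _,_) ∘ coprime-factorisation-unique a⊥b 0<a
      (∣**⇒∣ d₁∣**a) (∣**⇒∣ d₂∣**b) (∣**⇒∣ d₁′∣**a) (∣**⇒∣ d₂′∣**b)

  to : ∀ {d} → d ∈ map (uncurry _*_) pairs → d ∈ biunitaryDivisors (a * b)
  to d∈ = case ∈-map⁻ (uncurry _*_) d∈ of λ where
    (_ , p∈ , refl) → ∈-biunitaryDivisors⁺ 0<ab (uncurry (∣**-*⁺ a⊥b) (∈pairs⁻ p∈))

  from : ∀ {d} → d ∈ biunitaryDivisors (a * b) → d ∈ map (uncurry _*_) pairs
  from d∈ = case ∣**-*⁻ a⊥b 0<ab (∈-biunitaryDivisors⁻ 0<ab d∈) of λ where
    (_ , _ , refl , d₁∣**a , d₂∣**b) →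
      ∈-map⁺ (uncurry _*_)
        (∈-cartesianProduct⁺ (∈-biunitaryDivisors⁺ 0<a d₁∣**a) (∈-biunitaryDivisors⁺ 0<b d₂∣**b))

  products↭divisors : map (uncurry _*_) pairs ↭ biunitaryDivisors (a * b)
  products↭divisors = unique∧⇔⇒↭
    (unique-map⁺ product-injective
      (Unique.cartesianProduct⁺ (divisorsWith-unique gcud a) (divisorsWith-unique gcud b)))
    (divisorsWith-unique gcud (a * b)) (mk⇔ to from)

2∣σ** : 1 < n → ¬ 2 ∣ n → 2 ∣ σ** n
2∣σ** {n} 1<n 2∤n = ∣sum-involution (cofactor n) (divisorsWith-unique gcud n)
  (∈-biunitaryDivisors⁺ 0<n ∘ closed ∘ ∈⁻) (involutive ∘ ∈⁻) (fixFree ∘ ∈⁻) (pair-even ∘ ∈⁻)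
  where
  0<n : 0 < n
  0<n = <-trans z<s 1<n
  ∈⁻ : ∀ {d} → d ∈ biunitaryDivisors n → d ∣** n
  ∈⁻ = ∈-biunitaryDivisors⁻ 0<n
  cofactor≡ : ∀ d {e} → d * e ≡ n → cofactor n d ≡ e
  cofactor≡ d de≡n = cofactor-* (∣⇒>0 0<n (m*n≡o⇒m∣o d _ de≡n)) de≡n

  closed : ∀ {d} → d ∣** n → cofactor n d ∣** n
  closed {d} (e , de≡n , d⊥e) =
    subst (_∣** n) (sym (cofactor≡ d de≡n)) (d , trans (*-comm e d) de≡n , unitarilyCoprime-sym d⊥e)

  involutive : ∀ {d} → d ∣** n → cofactor n (cofactor n d) ≡ d
  involutive {d} (e , de≡n , _) =
    trans (cong (cofactor n) (cofactor≡ d de≡n)) (cofactor≡ e (trans (*-comm e d) de≡n))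

  fixFree : ∀ {d} → d ∣** n → cofactor n d ≢ d
  fixFree {d} (e , de≡n , d⊥e) n/d≡d = <-irrefl refl (subst (1 <_) n≡1 1<n)
    where
    e≡d = trans (sym (cofactor≡ d de≡n)) n/d≡d
    d≡1 = unitarilyCoprime[n,n]⇒n≡1 (subst (UnitarilyCoprime d) e≡d d⊥e)
    n≡1 : n ≡ 1
    n≡1 = trans (sym de≡n) (cong₂ _*_ d≡1 (trans e≡d d≡1))

  pair-even : ∀ {d} → d ∣** n → 2 ∣ d + cofactor n d
  pair-even {d} (e , de≡n , _) = subst (λ c → 2 ∣ d + c) (sym (cofactor≡ d de≡n)) (
    odd+odd⇒even (2∤n ∘ flip ∣-trans (m*n≡o⇒m∣o d e de≡n)) (2∤n ∘ flip ∣-trans (m*n≡o⇒n∣o d e de≡n)))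

p∤σ**[p^k] : Prime p → ∀ k → ¬ p ∣ σ** (p ^ k)
p∤σ**[p^k] {p} pr k p∣σ = >⇒≢ (nonTrivial⇒n>1 p {{prime⇒nonTrivial pr}}) (∣1⇒≡1 p∣1)
  where
  instance _ = prime⇒nonZero pr
  0<pᵏ = m^n>0 p k
  ds = biunitaryDivisors (p ^ k)
  ≢1? = λ d → ¬? (d ≟ 1)

  σ≡others+1 : σ** (p ^ k) ≡ sum (filter ≢1? ds) + 1
  σ≡others+1 = trans (sum≡x+sum[filter≢x] (divisorsWith-unique gcud (p ^ k))
                                           (∈-biunitaryDivisors⁺ 0<pᵏ (1∣** (p ^ k))))
                     (+-comm 1 _)

  p∣others : p ∣ sum (filter ≢1? ds)
  p∣others = ∣sum λ d∈ → let d∈ds , d≢1 = ∈-filter⁻ ≢1? {xs = ds} d∈ in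
                         ∣p^k∧≢1⇒p∣ pr k (∣**⇒∣ (∈-biunitaryDivisors⁻ 0<pᵏ d∈ds)) d≢1

  p∣1 : p ∣ 1
  p∣1 = ∣m+n∣m⇒∣n (subst (p ∣_) σ≡others+1 p∣σ) p∣others

4∣σ**[a*b] : Coprime a b → 1 < a → 1 < b → ¬ 2 ∣ a * b → 2 * 2 ∣ σ** (a * b)
4∣σ**[a*b] {a} {b} a⊥b 1<a 1<b 2∤ab =
  subst (2 * 2 ∣_) (sym (σ**-multiplicative a⊥b (<-trans z<s 1<a) (<-trans z<s 1<b)))
  (*-pres-∣ (2∣σ** 1<a (2∤ab ∘ ∣m⇒∣m*n b)) (2∣σ** 1<b (2∤ab ∘ ∣n⇒∣m*n a)))

-- The equation σ**(N) = 3N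

prime[3] : Prime 3
prime[3] = from-yes (prime? 3)

prime[5] : Prime 5
prime[5] = from-yes (prime? 5)

3ᶠ⊥16 : ∀ f → Coprime (3 ^ f) 16
3ᶠ⊥16 = coprime-^ˡ (prime∤⇒coprime prime[3] (from-no (3 ∣? 16)))

2⁴3ᶠ-factorisation : ∀ f → 2 ^ 4 ∥ n → 3 ^ f ∥ n → ∃[ m ] n ≡ 16 * (3 ^ f * m) × ¬ 2 ∣ m × ¬ 3 ∣ m
2⁴3ᶠ-factorisation {n} f 2⁴∥n 3ᶠ∥n
  with n₁ , n≡16n₁ , 2∤n₁ ← ∥⇒≡^*∤ 2 4 2⁴∥n
  with m , n₁≡3ᶠm , 3∤m ← ∥⇒≡^*∤ 3 f (∥-cancelˡ 3 f (3ᶠ⊥16 f) (subst (3 ^ f ∥_) n≡16n₁ 3ᶠ∥n))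
  = m , trans n≡16n₁ (cong (16 *_) n₁≡3ᶠm) ,
    2∤n₁ ∘ flip ∣-trans (m*n≡o⇒n∣o (3 ^ f) m (sym n₁≡3ᶠm)) , 3∤m

-- σ** 16 = 1 + 2 + 8 + 16 = 27 holds by evaluation.
σ**[16*3ᶠ*m] : ∀ f → 0 < m → ¬ 2 ∣ m → ¬ 3 ∣ m → σ** (16 * (3 ^ f * m)) ≡ 27 * (σ** (3 ^ f) * σ** m)
σ**[16*3ᶠ*m] {m} f 0<m 2∤m 3∤m = begin
  σ** (16 * (3 ^ f * m))    ≡⟨ σ**-multiplicative 16⊥3ᶠm z<s (*-mono-< (m^n>0 3 f) 0<m) ⟩
  σ** 16 * σ** (3 ^ f * m)  ≡⟨ cong (σ** 16 *_) (σ**-multiplicative 3ᶠ⊥m (m^n>0 3 f) 0<m) ⟩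
  27 * (σ** (3 ^ f) * σ** m) ∎
  where
  open ≡-Reasoning
  16⊥3ᶠm : Coprime 16 (3 ^ f * m)
  16⊥3ᶠm = coprime-*ʳ (Coprimality.sym (3ᶠ⊥16 f)) (coprime-^ˡ (prime∤⇒coprime prime[2] 2∤m) 4)
  3ᶠ⊥m : Coprime (3 ^ f) m
  3ᶠ⊥m = coprime-^ˡ (prime∤⇒coprime prime[3] 3∤m) f

odd-7σ**≢9* : 0 < m → ¬ 2 ∣ m → 7 * σ** m ≢ 9 * m
odd-7σ**≢9* {m} 0<m 2∤m 7σ≡9m = case m ≟ 1 of λ where
  (yes refl) → contradiction 7σ≡9m λ ()
  (no  m≢1)  → 2∤m (coprime-divisor (prime∤⇒coprime prime[2] (from-no (2 ∣? 9)))
                     (subst (2 ∣_) 7σ≡9m (∣n⇒∣m*n 7 (2∣σ** (≤∧≢⇒< 0<m (m≢1 ∘ sym)) 2∤m))))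

5σ**[5^g]≡6*5^g⇒g≡1 : ∀ g → 5 * σ** (5 ^ g) ≡ 6 * 5 ^ g → g ≡ 1
5σ**[5^g]≡6*5^g⇒g≡1 zero          ()
5σ**[5^g]≡6*5^g⇒g≡1 (suc zero)    _     = refl
5σ**[5^g]≡6*5^g⇒g≡1 (suc (suc g)) 5σ≡6*5ᵍ = contradiction 5∣σ (p∤σ**[p^k] prime[5] (2 + g))
  where
  σ≡6*5^g : σ** (5 ^ (2 + g)) ≡ 6 * 5 ^ (1 + g)
  σ≡6*5^g = *-cancelˡ-≡ _ _ 5 (trans 5σ≡6*5ᵍ (*-reassoc 6 5 5 6 (5 ^ (1 + g)) refl))
  5∣σ : 5 ∣ σ** (5 ^ (2 + g))
  5∣σ = subst (5 ∣_) (sym σ≡6*5^g) (∣n⇒∣m*n 6 (m∣m*n (5 ^ g)))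

odd-5σ**≡6*⇒≡5 : 0 < m → ¬ 2 ∣ m → 5 * σ** m ≡ 6 * m → m ≡ 5
odd-5σ**≡6*⇒≡5 {m} 0<m 2∤m 5σ≡6m = case factorOut 5 m 0<m of λ where
    (zero  , k , m≡k , 5∤k)   → contradiction (subst (5 ∣_) (trans m≡k (*-identityˡ k)) 5∣m) 5∤k
    (suc g , k , m≡5ᵍk , 5∤k) → case k ≟ 1 of λ where
      (yes refl) → m≡5ᵍ⇒m≡5 {suc g} (trans m≡5ᵍk (*-identityʳ (5 ^ suc g)))
      (no  k≢1)  → contradiction (subst (λ x → 2 * 2 ∣ σ** x) (sym m≡5ᵍk)
                     (4∣σ**[a*b] (coprime-^ˡ (prime∤⇒coprime prime[5] 5∤k) (suc g))
                                 (^-monoʳ-< 5 (s≤s (s≤s z≤n)) {0} {suc g} z<s)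
                                 (≤∧≢⇒< (m*n>0⇒n>0 (5 ^ suc g) (subst (0 <_) m≡5ᵍk 0<m)) (k≢1 ∘ sym))
                                 (subst (λ x → ¬ 2 ∣ x) m≡5ᵍk 2∤m)))
                   4∤σ
  where
  5∣m : 5 ∣ m
  5∣m = coprime-divisor (prime∤⇒coprime prime[5] (from-no (5 ∣? 6))) (subst (5 ∣_) 5σ≡6m (m∣m*n (σ** m)))

  4∤σ : ¬ 2 * 2 ∣ σ** m
  4∤σ 4∣σ = 2∤m (coprime-divisor (prime∤⇒coprime prime[2] (from-no (2 ∣? 3)))
                  (*-cancelˡ-∣ 2 (subst (2 * 2 ∣_) (trans 5σ≡6m (*-assoc 2 3 m)) (∣n⇒∣m*n 5 4∣σ))))

  m≡5ᵍ⇒m≡5 : ∀ {g} → m ≡ 5 ^ g → m ≡ 5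
  m≡5ᵍ⇒m≡5 {g} m≡5ᵍ =
    trans m≡5ᵍ (cong (5 ^_) (5σ**[5^g]≡6*5^g⇒g≡1 g (subst (λ x → 5 * σ** x ≡ 6 * x) m≡5ᵍ 5σ≡6m)))

-- σ** 27 = 1 + 3 + 9 + 27 = 40 and σ** 81 = 1 + 3 + 27 + 81 = 112 hold by evaluation.
16*3ᶠ*m≡2160 : ∀ f → 3 ≤ f → f ≤ 4 → 0 < m → ¬ 2 ∣ m →
               27 * (σ** (3 ^ f) * σ** m) ≡ 3 * (16 * (3 ^ f * m)) → 16 * (3 ^ f * m) ≡ 2160
16*3ᶠ*m≡2160 {m} 3 _ _ 0<m 2∤m balance =
  cong (λ x → 16 * (27 * x)) (odd-5σ**≡6*⇒≡5 0<m 2∤m (*-cancelˡ-≡ _ _ 216 (begin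
  216 * (5 * σ** m)        ≡⟨ *-reassoc 216 5 27 40 (σ** m) refl ⟩
  27 * (40 * σ** m)        ≡⟨ balance ⟩
  3 * (16 * (27 * m))      ≡⟨ *-assoc 3 16 (27 * m) ⟨
  48 * (27 * m)            ≡⟨ *-reassoc 48 27 216 6 m refl ⟩
  216 * (6 * m)            ∎)))
  where open ≡-Reasoning
16*3ᶠ*m≡2160 {m} 4 _ _ 0<m 2∤m balance = contradiction (*-cancelˡ-≡ _ _ 432 (begin
  432 * (7 * σ** m)        ≡⟨ *-reassoc 432 7 27 112 (σ** m) refl ⟩
  27 * (112 * σ** m)       ≡⟨ balance ⟩
  3 * (16 * (81 * m))      ≡⟨ *-assoc 3 16 (81 * m) ⟨
  48 * (81 * m)            ≡⟨ *-reassoc 48 81 432 9 m refl ⟩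
  432 * (9 * m)            ∎)) (odd-7σ**≢9* 0<m 2∤m)
  where open ≡-Reasoning
16*3ᶠ*m≡2160 0 () _
16*3ᶠ*m≡2160 1 (s≤s ()) _
16*3ᶠ*m≡2160 2 (s≤s (s≤s ())) _
16*3ᶠ*m≡2160 (suc (suc (suc (suc (suc _))))) _ (s≤s (s≤s (s≤s (s≤s ()))))

lemma3p6 : (N e f : ℕ) → 0 < N → σ** N ≡ 3 * N
         → 2 ^ e ∥ N → 3 ^ f ∥ N
         → e ≡ 4 → 3 ≤ f → f ≤ 4
         → N ≡ 2160
lemma3p6 N _ f 0<N σN≡3N 2⁴∥N 3ᶠ∥N refl 3≤f f≤4 =
  let m , N≡16*3ᶠ*m , 2∤m , 3∤m = 2⁴3ᶠ-factorisation f 2⁴∥N 3ᶠ∥N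
      0<m = m*n>0⇒n>0 (3 ^ f) (m*n>0⇒n>0 16 (subst (0 <_) N≡16*3ᶠ*m 0<N))
      balance = trans (sym (σ**[16*3ᶠ*m] f 0<m 2∤m 3∤m)) (subst (λ n → σ** n ≡ 3 * n) N≡16*3ᶠ*m σN≡3N)
  in  trans N≡16*3ᶠ*m (16*3ᶠ*m≡2160 f 3≤f f≤4 0<m 2∤m balance)
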